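{- Let $n\ge2$ and let $M$ be a max shuffle on $S_n$. Then $\operatorname{tn}M=2n-3$.
   Context: $[n]=\{1,\dots,n\}$, $[a,b]=\{a,\dots,b\}$; $S_n$ is the group of bijections $[n]\to[n]$. A homing shuffle is a map $F:S_n\to S_n$ such that for every $w\in S_n$, setting $k:=w(1)$: (a) $F(w)(k)=k$, and (b) $F(w)(i)=w(i)$ for all $i>k$. A max shuffle is a homing shuffle $M$ such that for every $w\in S_n$ with $w(1)\neq1$, $M(w)(1)=\max(w([2,k]))$ where $k=w(1)$. The termination number $\operatorname{tn}F$ is the smallest $m\in\mathbb{N}$ such that $F^m(w)(1)=1$ for all $w\in S_n$ ($F^m$ the $m$-th iterate). -}

module Defs where

open import Data.Nat using (ℕ; zero; suc; _≤_; _<_; _⊔_; _≤?_)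
open import Data.Fin using (Fin; toℕ; zero; suc)
open import Data.Fin.Permutation using (Permutation′; _⟨$⟩ʳ_)
open import Data.List using (List; foldr; map; filter; allFin)
open import Data.Product using (_×_)
open import Relation.Binary.PropositionalEquality using (_≡_)
open import Relation.Nullary using (¬_)
open import Relation.Nullary.Decidable using (_×-dec_)

-- Position/value  i ∈ [n]  of the paper is  Fin n  element with  toℕ = i - 1.
-- Definitions are stated for S_N with N = suc n (so that position 1 exists).
-- So the paper's "1" is  zero, and  w(1) = w ⟨$⟩ʳ zero.

-- max of w over the positions [2,k] (paper), i.e. 0-indexed positions j with
-- 1 ≤ toℕ j ≤ toℕ k, values measured by toℕ (order-isomorphic to [n]).
segMax : {n : ℕ} → Permutation′ n → Fin n → ℕ
segMax {n} w k =
  foldr _⊔_ 0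
    (map (λ j → toℕ (w ⟨$⟩ʳ j))
      (filter (λ j → (1 ≤? toℕ j) ×-dec (toℕ j ≤? toℕ k)) (allFin n)))

IsHomingShuffle : {n : ℕ} → (Permutation′ (suc n) → Permutation′ (suc n)) → Set
IsHomingShuffle {n} F =
  (w : Permutation′ (suc n)) →
    (F w ⟨$⟩ʳ (w ⟨$⟩ʳ zero) ≡ w ⟨$⟩ʳ zero)
    × ((i : Fin (suc n)) → toℕ (w ⟨$⟩ʳ zero) < toℕ i → F w ⟨$⟩ʳ i ≡ w ⟨$⟩ʳ i)

IsMaxShuffle : {n : ℕ} → (Permutation′ (suc n) → Permutation′ (suc n)) → Set
IsMaxShuffle {n} M =
  IsHomingShuffle M
  × ((w : Permutation′ (suc n)) → ¬ (toℕ (w ⟨$⟩ʳ zero) ≡ 0) →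
       toℕ (M w ⟨$⟩ʳ zero) ≡ segMax w (w ⟨$⟩ʳ zero))

iter : {A : Set} → (A → A) → ℕ → A → A
iter f zero x = x
iter f (suc m) x = f (iter f m x)

TerminatesIn : {n : ℕ} → (Permutation′ (suc n) → Permutation′ (suc n)) → ℕ → Set
TerminatesIn {n} F m = (w : Permutation′ (suc n)) → toℕ (iter F m w ⟨$⟩ʳ zero) ≡ 0

HasTerminationNumber : {n : ℕ} → (Permutation′ (suc n) → Permutation′ (suc n)) → ℕ → Set
HasTerminationNumber F m =
  TerminatesIn F m × ((m′ : ℕ) → m′ < m → ¬ TerminatesIn F m′)

-- A max shuffle moves w(1) at every step until w(1) = 1.  Once w(1) has dropped it keeps
-- dropping: the entries of M w in front of position M(w)(1) come from w([2,k]), so they are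
-- at most max w([2,k]) = M(w)(1).  Thus w(1) first rises strictly and then falls strictly,
-- which takes at most (n − w(1)) + (n − 1) ≤ 2n − 3 steps when w(1) ≥ 2.  The permutation
-- 2 3 ⋯ n 1 is extremal: w(1) climbs by one from 2 up to n and then sinks by one back to 2,
-- so after 2n − 4 steps it is still not 1.
module Submission where

open import Defs
open import Data.Empty using (⊥-elim)
open import Data.Fin using (Fin; zero; suc; toℕ; fromℕ; fromℕ<; inject₁; lower₁)
open import Data.Fin.Properties
  using (toℕ-injective; toℕ<n; toℕ-fromℕ; toℕ-fromℕ<; toℕ-inject₁-≢; toℕ-lower₁; inject₁-lower₁; lower₁-inject₁′)
open import Data.Fin.Permutation using (Permutation′; _⟨$⟩ʳ_; _⟨$⟩ˡ_; inverseʳ; permutation)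
open import Data.List using (List; map; filter; allFin)
open import Data.List.Membership.Propositional using (_∈_)
open import Data.List.Membership.Propositional.Properties using (∈-allFin; ∈-map∘filter⁺; ∈-map∘filter⁻)
open import Data.List.Properties using (foldr-forcesᵇ; foldr-preservesᵇ)
import Data.List.Relation.Unary.All as All
open import Data.Nat using (ℕ; zero; suc; _+_; _*_; _∸_; _⊔_; _≤_; _<_; z≤n; s≤s; s≤s⁻¹; _≤?_; _<?_; _≟_)
open import Data.Nat.Properties
open import Data.Product using (_×_; _,_; proj₁; proj₂)
open import Data.Sum using (_⊎_; inj₁; inj₂)
open import Function.Base using (_∘′_)
open import Function.Bundles using (Injection)
open import Function.Properties.Inverse using (↔⇒↣)
open import Relation.Binary.PropositionalEquality
open import Relation.Nullary using (¬_; Dec; yes; no; contradiction)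
open import Relation.Nullary.Decidable using (_×-dec_)

iter-suc : ∀ {A : Set} (f : A → A) m x → iter f (suc m) x ≡ iter f m (f x)
iter-suc f zero    x = refl
iter-suc f (suc m) x = cong f (iter-suc f m x)

iter-+ : ∀ {A : Set} (f : A → A) m k x → iter f (m + k) x ≡ iter f m (iter f k x)
iter-+ f zero    k x = refl
iter-+ f (suc m) k x = cong f (iter-+ f m k x)

toℕ-⟨$⟩ʳ-injective : ∀ {n} (π : Permutation′ n) {i j} → toℕ (π ⟨$⟩ʳ i) ≡ toℕ (π ⟨$⟩ʳ j) → i ≡ j
toℕ-⟨$⟩ʳ-injective π = Injection.injective (↔⇒↣ π) ∘′ toℕ-injective

InWindow : ∀ {n} → ℕ → Fin n → Set
InWindow m j = 1 ≤ toℕ j × toℕ j ≤ m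

inWindow? : ∀ {n} m (j : Fin n) → Dec (InWindow m j)
inWindow? m j = (1 ≤? toℕ j) ×-dec (toℕ j ≤? m)

windowValues : ∀ {n} → Permutation′ n → Fin n → List ℕ
windowValues {n} w k = map (λ j → toℕ (w ⟨$⟩ʳ j)) (filter (inWindow? (toℕ k)) (allFin n))

segMax-upperBound : ∀ {n} (w : Permutation′ n) k j → InWindow (toℕ k) j →
  toℕ (w ⟨$⟩ʳ j) ≤ segMax w k
segMax-upperBound w k j j∈ =
  All.lookup (foldr-forcesᵇ {P = _≤ segMax w k} (λ x y x⊔y≤ → m⊔n≤o⇒m≤o x y x⊔y≤ , m⊔n≤o⇒n≤o x y x⊔y≤)
                0 (windowValues w k) ≤-refl)
    (∈-map∘filter⁺ (λ i → toℕ (w ⟨$⟩ʳ i)) (inWindow? (toℕ k)) (j , ∈-allFin j , refl , j∈))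

segMax-preserves : ∀ {n} {P : ℕ → Set} (w : Permutation′ n) k →
  (∀ {x y} → P x → P y → P (x ⊔ y)) → P 0 →
  (∀ j → InWindow (toℕ k) j → P (toℕ (w ⟨$⟩ʳ j))) → P (segMax w k)
segMax-preserves {n} {P} w k pres P0 window = foldr-preservesᵇ pres P0 (All.tabulate valueP)
  where
  valueP : ∀ {x} → x ∈ windowValues w k → P x
  valueP x∈ with ∈-map∘filter⁻ (λ i → toℕ (w ⟨$⟩ʳ i)) (inWindow? (toℕ k))
                   {f = λ i → toℕ (w ⟨$⟩ʳ i)} {xs = allFin n} x∈
  ... | j , _ , refl , j∈ = window j j∈

first : ∀ {n} → Permutation′ (suc n) → ℕ
first w = toℕ (w ⟨$⟩ʳ zero)

first-≤ : ∀ {n} (w : Permutation′ (suc n)) → first w ≤ n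
first-≤ w = s≤s⁻¹ (toℕ<n (w ⟨$⟩ʳ zero))

first-only-at-zero : ∀ {n} (w : Permutation′ (suc n)) {j} → toℕ (w ⟨$⟩ʳ j) ≡ first w → toℕ j ≡ 0
first-only-at-zero w e = cong toℕ (toℕ-⟨$⟩ʳ-injective w e)

rotate : ∀ {n} → Fin (suc n) → Fin (suc n)
rotate {n} i with n ≟ toℕ i
... | yes _   = zero
... | no n≢i = suc (lower₁ i n≢i)

unrotate : ∀ {n} → Fin (suc n) → Fin (suc n)
unrotate {n} zero    = fromℕ n
unrotate     (suc i) = inject₁ i

rotate-unrotate : ∀ {n} (i : Fin (suc n)) → rotate (unrotate i) ≡ i
rotate-unrotate {n} zero with n ≟ toℕ (fromℕ n)
... | yes _   = refl
... | no n≢n = contradiction (sym (toℕ-fromℕ n)) n≢n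
rotate-unrotate {n} (suc i) with n ≟ toℕ (inject₁ i)
... | yes n≡i = contradiction n≡i (toℕ-inject₁-≢ i)
... | no n≢i = cong suc (lower₁-inject₁′ i n≢i)

unrotate-rotate : ∀ {n} (i : Fin (suc n)) → unrotate (rotate i) ≡ i
unrotate-rotate {n} i with n ≟ toℕ i
... | yes n≡i = toℕ-injective (trans (toℕ-fromℕ n) n≡i)
... | no n≢i = inject₁-lower₁ i n≢i

-- The paper's permutation 2 3 ⋯ n 1.
rotation : ∀ {n} → Permutation′ (suc n)
rotation = permutation rotate unrotate rotate-unrotate unrotate-rotate

rotate-shifts : ∀ {n} (i : Fin (suc n)) → toℕ i < n → toℕ (rotate i) ≡ suc (toℕ i)
rotate-shifts {n} i i<n with n ≟ toℕ i
... | yes n≡i = contradiction i<n (<-irrefl (sym n≡i))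
... | no n≢i = cong suc (toℕ-lower₁ i n≢i)

ShiftedFrom : ∀ {n} → ℕ → Permutation′ (suc n) → Set
ShiftedFrom {n} f w = ∀ p → f ≤ toℕ p → toℕ p < n → toℕ (w ⟨$⟩ʳ p) ≡ suc (toℕ p)

FixedFrom : ∀ {n} → ℕ → Permutation′ (suc n) → Set
FixedFrom k w = ∀ p → k ≤ toℕ p → w ⟨$⟩ʳ p ≡ p

shifted-at : ∀ {n f} (w : Permutation′ (suc n)) → ShiftedFrom f w → ∀ {u} → f ≤ u → (u<n : u < n) →
  toℕ (w ⟨$⟩ʳ fromℕ< (m<n⇒m<1+n u<n)) ≡ suc u
shifted-at {n} {f} w shifted {u} f≤u u<n =
  trans (shifted _ (subst (f ≤_) (sym toℕ-pos) f≤u) (subst (_< n) (sym toℕ-pos) u<n)) (cong suc toℕ-pos)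
  where
  toℕ-pos : toℕ (fromℕ< (m<n⇒m<1+n u<n)) ≡ u
  toℕ-pos = toℕ-fromℕ< (m<n⇒m<1+n u<n)

shifted-position : ∀ {n f} (w : Permutation′ (suc n)) → ShiftedFrom f w → ∀ {u} j → f ≤ u → u < n →
  toℕ (w ⟨$⟩ʳ j) ≡ suc u → toℕ j ≡ u
shifted-position w shifted j f≤u u<n wj≡1+u =
  trans (cong toℕ (toℕ-⟨$⟩ʳ-injective w (trans wj≡1+u (sym (shifted-at w shifted f≤u u<n)))))
        (toℕ-fromℕ< (m<n⇒m<1+n u<n))

shifted-segMax : ∀ {n} (w : Permutation′ (suc n)) → ShiftedFrom (first w) w →
  1 ≤ first w → first w < n → segMax w (w ⟨$⟩ʳ zero) ≡ suc (first w)
shifted-segMax {n} w shifted 1≤k k<n = ≤-antisym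
  (segMax-preserves {P = _≤ suc (first w)} w _ ⊔-lub z≤n (λ j (_ , j≤k) → window-≤ j j≤k))
  (subst (_≤ segMax w (w ⟨$⟩ʳ zero)) (shifted-at w shifted ≤-refl k<n)
    (segMax-upperBound w _ _ (subst (1 ≤_) (sym toℕ-pos) 1≤k , ≤-reflexive toℕ-pos)))
  where
  toℕ-pos : toℕ (fromℕ< (m<n⇒m<1+n k<n)) ≡ first w
  toℕ-pos = toℕ-fromℕ< (m<n⇒m<1+n k<n)
  window-≤ : ∀ j → toℕ j ≤ first w → toℕ (w ⟨$⟩ʳ j) ≤ suc (first w)
  window-≤ j j≤k with toℕ (w ⟨$⟩ʳ j) in wj≡v
  ... | zero  = z≤n
  ... | suc u with u ≤? first w
  ...   | yes u≤k = s≤s u≤k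
  ...   | no  u≰k =
    ⊥-elim (<⇒≱ (≰⇒> u≰k) (subst (_≤ first w) (shifted-position w shifted j k≤u u<n wj≡v) j≤k))
    where
    k≤u : first w ≤ u
    k≤u = <⇒≤ (≰⇒> u≰k)
    u<n : u < n
    u<n = s≤s⁻¹ (subst (_< suc n) wj≡v (toℕ<n (w ⟨$⟩ʳ j)))

fixed-value : ∀ {n k} (w : Permutation′ (suc n)) → FixedFrom k w → ∀ j → k ≤ toℕ (w ⟨$⟩ʳ j) → w ⟨$⟩ʳ j ≡ j
fixed-value w fixed j k≤wj = toℕ-⟨$⟩ʳ-injective w (cong toℕ (fixed (w ⟨$⟩ʳ j) k≤wj))

fixed-segMax : ∀ {n g} (w : Permutation′ (suc n)) → FixedFrom (suc (first w)) w →
  first w ≡ suc g → segMax w (w ⟨$⟩ʳ zero) ≡ g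
fixed-segMax {n} {g} w fixed k≡1+g = ≤-antisym
  (s≤s⁻¹ (subst (segMax w (w ⟨$⟩ʳ zero) <_) k≡1+g
    (segMax-preserves {P = _< first w} w _ ⊔-pres-<m 1≤k window-<)))
  (subst (_≤ segMax w (w ⟨$⟩ʳ zero)) value-g (segMax-upperBound w _ pos-g pos-g-in-window))
  where
  1≤k : 1 ≤ first w
  1≤k = subst (1 ≤_) (sym k≡1+g) (s≤s z≤n)
  window-< : ∀ j → InWindow (first w) j → toℕ (w ⟨$⟩ʳ j) < first w
  window-< j (1≤j , j≤k) = ≤∧≢⇒< wj≤k (λ e → >⇒≢ 1≤j (first-only-at-zero w e))
    where
    wj≤k : toℕ (w ⟨$⟩ʳ j) ≤ first w
    wj≤k with toℕ (w ⟨$⟩ʳ j) ≤? first w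
    ... | yes wj≤k = wj≤k
    ... | no  wj≰k = ⊥-elim (<⇒≱ (≰⇒> wj≰k) (subst (λ i → toℕ i ≤ first w) wj≡j j≤k))
      where
      wj≡j : j ≡ w ⟨$⟩ʳ j
      wj≡j = sym (fixed-value w fixed j (≰⇒> wj≰k))
  g<1+n : g < suc n
  g<1+n = m<n⇒m<1+n (subst (_≤ n) k≡1+g (first-≤ w))
  pos-g : Fin (suc n)
  pos-g = w ⟨$⟩ˡ fromℕ< g<1+n
  value-g : toℕ (w ⟨$⟩ʳ pos-g) ≡ g
  value-g = trans (cong toℕ (inverseʳ w)) (toℕ-fromℕ< g<1+n)
  pos-g-in-window : InWindow (first w) pos-g
  pos-g-in-window with 1 ≤? toℕ pos-g | toℕ pos-g ≤? first w
  ... | yes 1≤p | yes p≤k = 1≤p , p≤k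
  ... | _       | no  p≰k = ⊥-elim (<-irrefl (sym p≡g) (<-trans g<k (≰⇒> p≰k)))
    where
    p≡g : toℕ pos-g ≡ g
    p≡g = trans (cong toℕ (sym (fixed pos-g (≰⇒> p≰k)))) value-g
    g<k : g < first w
    g<k = subst (g <_) (sym k≡1+g) (n<1+n g)
  ... | no  p≱1 | yes _   =
    ⊥-elim (1+n≢n (trans (sym k≡1+g) (trans (cong (λ i → toℕ (w ⟨$⟩ʳ i)) (sym p≡0)) value-g)))
    where
    p≡0 : pos-g ≡ zero
    p≡0 = toℕ-injective (n≤0⇒n≡0 (≮⇒≥ p≱1))

module Homing {n} {F : Permutation′ (suc n) → Permutation′ (suc n)} (homing : IsHomingShuffle F) where

  fixes-first : ∀ w → F w ⟨$⟩ʳ (w ⟨$⟩ʳ zero) ≡ w ⟨$⟩ʳ zero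
  fixes-first w = proj₁ (homing w)

  fixes-tail : ∀ w p → first w < toℕ p → F w ⟨$⟩ʳ p ≡ w ⟨$⟩ʳ p
  fixes-tail w = proj₂ (homing w)

  home-stable : ∀ w → first w ≡ 0 → first (F w) ≡ 0
  home-stable w e = begin
    toℕ (F w ⟨$⟩ʳ zero)               ≡⟨ cong (λ i → toℕ (F w ⟨$⟩ʳ i)) (sym w0≡0) ⟩
    toℕ (F w ⟨$⟩ʳ (w ⟨$⟩ʳ zero))      ≡⟨ cong toℕ (fixes-first w) ⟩
    first w                           ≡⟨ e ⟩
    0                                 ∎
    where
    open ≡-Reasoning
    w0≡0 : w ⟨$⟩ʳ zero ≡ zero
    w0≡0 = toℕ-injective e

  iter-home-stable : ∀ k w → first w ≡ 0 → first (iter F k w) ≡ 0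
  iter-home-stable zero    w e = e
  iter-home-stable (suc k) w e = home-stable (iter F k w) (iter-home-stable k w e)

  terminatesIn-mono : ∀ {m m′} → m ≤ m′ → TerminatesIn F m → TerminatesIn F m′
  terminatesIn-mono {m} {m′} m≤m′ term w = begin
    first (iter F m′ w)                  ≡⟨ cong (λ k → first (iter F k w)) (sym (m∸n+n≡m m≤m′)) ⟩
    first (iter F (m′ ∸ m + m) w)        ≡⟨ cong first (iter-+ F (m′ ∸ m) m w) ⟩
    first (iter F (m′ ∸ m) (iter F m w)) ≡⟨ iter-home-stable (m′ ∸ m) (iter F m w) (term w) ⟩
    0                                    ∎
    where open ≡-Reasoning

  first-moves : ∀ w → 1 ≤ first w → first (F w) ≢ first w
  first-moves w 1≤k e = >⇒≢ 1≤k (cong toℕ (sym 0≡w0))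
    where
    0≡w0 : zero ≡ w ⟨$⟩ʳ zero
    0≡w0 = toℕ-⟨$⟩ʳ-injective (F w) (trans e (sym (cong toℕ (fixes-first w))))

  -- Positions 0 and beyond first w of w are carried into positions ≥ first w of F w.
  front-from-window : ∀ w j → toℕ j < first w → InWindow (first w) (w ⟨$⟩ˡ (F w ⟨$⟩ʳ j))
  front-from-window w j j<k = source-in-window _ (inverseʳ w)
    where
    source-in-window : ∀ p → w ⟨$⟩ʳ p ≡ F w ⟨$⟩ʳ j → InWindow (first w) p
    source-in-window p wp with 1 ≤? toℕ p | toℕ p ≤? first w
    ... | yes 1≤p | yes p≤k = 1≤p , p≤k
    ... | _       | no p≰k  = ⊥-elim (<-asym j<k (subst (first w <_) (cong toℕ (sym j≡p)) (≰⇒> p≰k)))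
      where
      j≡p : j ≡ p
      j≡p = toℕ-⟨$⟩ʳ-injective (F w) (cong toℕ (trans (sym wp) (sym (fixes-tail w p (≰⇒> p≰k)))))
    ... | no p≱1  | yes _   = ⊥-elim (<-irrefl (cong toℕ j≡w0) j<k)
      where
      p≡0 : p ≡ zero
      p≡0 = toℕ-injective (n≤0⇒n≡0 (≮⇒≥ p≱1))
      j≡w0 : j ≡ w ⟨$⟩ʳ zero
      j≡w0 = toℕ-⟨$⟩ʳ-injective (F w)
               (cong toℕ (trans (sym wp) (trans (cong (w ⟨$⟩ʳ_) p≡0) (sym (fixes-first w)))))

  fixedFrom-step : ∀ w → FixedFrom (suc (first w)) w → FixedFrom (first w) (F w)
  fixedFrom-step w fixed p k≤p with m≤n⇒m<n∨m≡n k≤p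
  ... | inj₁ k<p = trans (fixes-tail w p k<p) (fixed p k<p)
  ... | inj₂ k≡p = begin
    F w ⟨$⟩ʳ p              ≡⟨ cong (F w ⟨$⟩ʳ_) p≡w0 ⟩
    F w ⟨$⟩ʳ (w ⟨$⟩ʳ zero)  ≡⟨ fixes-first w ⟩
    w ⟨$⟩ʳ zero             ≡⟨ p≡w0 ⟨
    p                       ∎
    where
    open ≡-Reasoning
    p≡w0 : p ≡ w ⟨$⟩ʳ zero
    p≡w0 = toℕ-injective (sym k≡p)

module Max {n} {M : Permutation′ (suc n) → Permutation′ (suc n)} (max : IsMaxShuffle M) where

  open Homing {F = M} (proj₁ max) public

  first-M≡segMax : ∀ w → 1 ≤ first w → first (M w) ≡ segMax w (w ⟨$⟩ʳ zero)
  first-M≡segMax w 1≤k = proj₂ max w (>⇒≢ 1≤k)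

  front-bounded : ∀ w j → 1 ≤ first w → toℕ j < first w → toℕ (M w ⟨$⟩ʳ j) ≤ first (M w)
  front-bounded w j 1≤k j<k = begin
    toℕ (M w ⟨$⟩ʳ j)                      ≡⟨ cong toℕ (sym (inverseʳ w)) ⟩
    toℕ (w ⟨$⟩ʳ (w ⟨$⟩ˡ (M w ⟨$⟩ʳ j)))    ≤⟨ segMax-upperBound w _ _ (front-from-window w j j<k) ⟩
    segMax w (w ⟨$⟩ʳ zero)                ≡⟨ first-M≡segMax w 1≤k ⟨
    first (M w)                           ∎
    where open ≤-Reasoning

  descent-persists : ∀ w → first (M w) < first w → 1 ≤ first (M w) → first (M (M w)) < first (M w)
  descent-persists w fall 1≤k′ =
    subst (_< first (M w)) (sym (first-M≡segMax (M w) 1≤k′))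
      (segMax-preserves {P = _< first (M w)} (M w) _ ⊔-pres-<m 1≤k′ below)
    where
    below : ∀ j → InWindow (first (M w)) j → toℕ (M w ⟨$⟩ʳ j) < first (M w)
    below j (1≤j , j≤k′) =
      ≤∧≢⇒< (front-bounded w j (≤-trans 1≤k′ (<⇒≤ fall)) (≤-<-trans j≤k′ fall))
            (λ e → >⇒≢ 1≤j (first-only-at-zero (M w) e))

  Descends : Permutation′ (suc n) → Set
  Descends w = 1 ≤ first w → first (M w) < first w

  first-M-positive : ∀ w → 1 ≤ first (M w) → 1 ≤ first w
  first-M-positive w 1≤k′ with 1 ≤? first w
  ... | yes 1≤k = 1≤k
  ... | no  1≰k = contradiction (home-stable w (n≤0⇒n≡0 (≮⇒≥ 1≰k))) (>⇒≢ 1≤k′)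

  descends-M : ∀ w → Descends w → Descends (M w)
  descends-M w d 1≤k′ = descent-persists w (d (first-M-positive w 1≤k′)) 1≤k′

  descends-terminates : ∀ k w → Descends w → first w ≤ k → first (iter M k w) ≡ 0
  descends-terminates zero    w d k≤0 = n≤0⇒n≡0 k≤0
  descends-terminates (suc m) w d k≤1+m rewrite iter-suc M m w =
    descends-terminates m (M w) (descends-M w d) first-M≤m
    where
    first-M≤m : first (M w) ≤ m
    first-M≤m with 1 ≤? first (M w)
    ... | yes 1≤k′ = s≤s⁻¹ (≤-trans (d (first-M-positive w 1≤k′)) k≤1+m)
    ... | no  1≰k′ = ≤-trans (≮⇒≥ 1≰k′) z≤n

  ascends-or-descends : ∀ w → first w < first (M w) ⊎ Descends w
  ascends-or-descends w with first (M w) <? first w | 1 ≤? first w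
  ... | yes fall  | _       = inj₂ (λ _ → fall)
  ... | no  _     | no  1≰k = inj₂ (λ 1≤k → contradiction 1≤k 1≰k)
  ... | no  ¬fall | yes 1≤k = inj₁ (≤∧≢⇒< (≮⇒≥ ¬fall) (≢-sym (first-moves w 1≤k)))

  terminates-within : ∀ k w → n + n ≤ k + first w → first (iter M k w) ≡ 0
  terminates-within k w bound with ascends-or-descends w
  ... | inj₂ d = descends-terminates k w d (+-cancelʳ-≤ (first w) (first w) k
                   (≤-trans (+-mono-≤ (first-≤ w) (first-≤ w)) bound))
  terminates-within zero w bound | inj₁ rise =
    ⊥-elim (<⇒≱ (<-≤-trans rise (≤-trans (first-≤ (M w)) (m≤m+n n n))) bound)
  terminates-within (suc m) w bound | inj₁ rise rewrite iter-suc M m w =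
    terminates-within m (M w) (begin
      n + n                 ≤⟨ bound ⟩
      suc m + first w       ≡⟨ +-suc m (first w) ⟨
      m + suc (first w)     ≤⟨ +-monoʳ-≤ m rise ⟩
      m + first (M w)       ∎)
    where open ≤-Reasoning

  upper-bound : ∀ k → n + n ≤ suc k → TerminatesIn M k
  upper-bound k bound w with 1 ≤? first w
  ... | yes 1≤k = terminates-within k w (≤-trans bound (subst (_≤ k + first w) (+-comm k 1) (+-monoʳ-≤ k 1≤k)))
  ... | no  1≰k = iter-home-stable k w (n≤0⇒n≡0 (≮⇒≥ 1≰k))

  Climbing : ℕ → Permutation′ (suc n) → Set
  Climbing f w = first w ≡ f × ShiftedFrom f w

  Sinking : ℕ → Permutation′ (suc n) → Set
  Sinking g w = first w ≡ g × FixedFrom (suc g) w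

  climbing-step : ∀ {f w} → 1 ≤ f → f < n → Climbing f w → Climbing (suc f) (M w)
  climbing-step {w = w} 1≤k k<n (refl , shifted) =
    trans (first-M≡segMax w 1≤k) (shifted-segMax w shifted 1≤k k<n) ,
    λ p k<p p<n → trans (cong toℕ (fixes-tail w p k<p)) (shifted p (<⇒≤ k<p) p<n)

  sinking-step : ∀ {g w} → Sinking (suc g) w → Sinking g (M w)
  sinking-step {g} {w} (k≡1+g , fixed) =
    trans (first-M≡segMax w (subst (1 ≤_) (sym k≡1+g) (s≤s z≤n))) (fixed-segMax w fixed′ k≡1+g) ,
    subst (λ k → FixedFrom k (M w)) k≡1+g (fixedFrom-step w fixed′)
    where
    fixed′ : FixedFrom (suc (first w)) w
    fixed′ = subst (λ k → FixedFrom (suc k) w) (sym k≡1+g) fixed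

  climbing-iter : ∀ t → suc t ≤ n → Climbing (suc t) (iter M t rotation)
  climbing-iter zero    1≤n = rotate-shifts zero 1≤n , λ p _ p<n → rotate-shifts p p<n
  climbing-iter (suc t) 2+t≤n = climbing-step (s≤s z≤n) 2+t≤n (climbing-iter t (<⇒≤ 2+t≤n))

  sinking-iter : ∀ t {g} w → Sinking (g + t) w → Sinking g (iter M t w)
  sinking-iter zero    {g} w sinking = subst (λ h → Sinking h w) (+-identityʳ g) sinking
  sinking-iter (suc t) {g} w sinking =
    sinking-step (sinking-iter t w (subst (λ h → Sinking h w) (+-suc g t) sinking))

rotation-late : ∀ {n₁} {M : Permutation′ (suc (suc n₁)) → Permutation′ (suc (suc n₁))} →
  IsMaxShuffle M → first (iter M (n₁ + n₁) rotation) ≡ 1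
rotation-late {n₁} {M} max = begin
  first (iter M (n₁ + n₁) rotation)          ≡⟨ cong first (iter-+ M n₁ n₁ rotation) ⟩
  first (iter M n₁ (iter M n₁ rotation))     ≡⟨ proj₁ (sinking-iter n₁ (iter M n₁ rotation) summit) ⟩
  1                                          ∎
  where
  open ≡-Reasoning
  open Max max
  summit : Sinking (suc n₁) (iter M n₁ rotation)
  summit = proj₁ (climbing-iter n₁ ≤-refl) , λ p 2+n₁≤p → ⊥-elim (<⇒≱ (toℕ<n p) 2+n₁≤p)

lower-bound : ∀ {n₁} {M : Permutation′ (suc (suc n₁)) → Permutation′ (suc (suc n₁))} →
  IsMaxShuffle M → ∀ m → m ≤ n₁ + n₁ → ¬ TerminatesIn M m
lower-bound max m m≤2n₁ term =
  1+n≢0 (trans (sym (rotation-late max)) (terminatesIn-mono m≤2n₁ term rotation))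
  where open Max max

twice-∸-three : ∀ m → 2 * suc (suc m) ∸ 3 ≡ suc (m + m)
twice-∸-three m = begin
  m + suc (suc (m + 0)) ∸ 1  ≡⟨ cong (λ k → m + suc (suc k) ∸ 1) (+-identityʳ m) ⟩
  m + suc (suc m) ∸ 1        ≡⟨ cong (_∸ 1) (+-suc m (suc m)) ⟩
  suc (m + suc m) ∸ 1        ≡⟨ +-suc m m ⟩
  suc (m + m)                ∎
  where open ≡-Reasoning

theorem7 : (n : ℕ) → 2 ≤ suc n → (M : Permutation′ (suc n) → Permutation′ (suc n)) →
    IsMaxShuffle M → HasTerminationNumber M (2 * suc n ∸ 3)
theorem7 zero (s≤s ()) M max
theorem7 (suc n₁) _ M max rewrite twice-∸-three n₁ =
  upper-bound (suc (n₁ + n₁)) (≤-reflexive (cong suc (+-suc n₁ n₁))) ,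
  λ m m<tn → lower-bound max m (s≤s⁻¹ m<tn)
  where open Max max
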